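{- Let $p>1$ be an integer and let $u^{(p)}$ be the fixed point of the substitution $\varphi_p(L)=L^pS$, $\varphi_p(S)=M$, $\varphi_p(M)=L^{p-1}S$ starting with $L$. Let $Sz'S$ be a factor of $u^{(p)}$ such that $z'$ contains no letter $S$. Then $z'=L^p$, or $z'=ML^p$, or $z'=ML^{p-1}$.
   Context: A factor is a finite contiguous block of $u^{(p)}$; $L^k$ denotes $k$ consecutive copies of $L$. -}

module Defs where

open import Data.Nat using (ℕ; zero; suc; _+_; _∸_)
open import Data.List using (List; []; _∷_; _++_; replicate; concatMap; map; upTo; length)
open import Data.Product using (∃)
open import Relation.Binary.PropositionalEquality using (_≡_)
open import Data.List.Relation.Unary.All using (All)
open import Relation.Nullary using (¬_)

data Letter : Set where
  L S M : Letter

Word : Set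
Word = List Letter

φ : ℕ → Letter → Word
φ p L = replicate p L ++ (S ∷ [])
φ p S = M ∷ []
φ p M = replicate (p ∸ 1) L ++ (S ∷ [])

φ* : ℕ → Word → Word
φ* p = concatMap (φ p)

iter : ℕ → ℕ → Word
iter p zero    = L ∷ []
iter p (suc n) = φ* p (iter p n)

-- Index into a finite word with a default value (never used out of range
-- below, since |φ_p^(i+1)(L)| > i for p ≥ 1).
nth : Word → ℕ → Letter
nth []       _       = L
nth (x ∷ w)  zero    = x
nth (x ∷ w)  (suc i) = nth w i

-- The fixed point u^(p) = lim φ_p^n(L) as an infinite word ℕ → Letter:
-- its i-th letter is the i-th letter of the prefix φ_p^(i+1)(L).
u : ℕ → ℕ → Letter
u p i = nth (iter p (suc i)) i

window : (ℕ → Letter) → ℕ → ℕ → Word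
window x i n = map (λ k → x (i + k)) (upTo n)

Factor : ℕ → Word → Set
Factor p w = ∃ λ i → window (u p) i (length w) ≡ w

NoS : Word → Set
NoS z = All (λ a → ¬ (a ≡ S)) z

-- Every S of φ_p(w) ends a block φ_p(L) = L^p S or φ_p(M) = L^(p-1) S, so
-- a gap S z′ S sits in φ_p(v) right after such a block, and z′ is read off
-- the next one or two letters of v: L gives L^p, S L gives M L^p, S M gives
-- M L^(p-1).  The other patterns (L M, M M, S S) are excluded because the
-- two-letter factors of φ_p^n(L) obey an invariant preserved by φ_p: any
-- letter may precede L, only L or M precede S, and only S precedes M.
module Submission where

open import Defs
open import Data.Nat using (ℕ; zero; suc; _+_; _∸_; _<_; _≤_; _≤′_; ≤′-refl; ≤′-step; z≤n; s≤s)
open import Data.Nat.Properties using (≤-trans; <⇒≤; ≤⇒≤′; n≤1+n; m<n⇒m<1+n; +-monoʳ-<)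
open import Data.List using (List; []; _∷_; _++_; replicate; length; drop; applyUpTo)
open import Data.List.Properties
  using (∷-injective; ++-assoc; ++-identityʳ; concatMap-++; map-upTo; length-++-≤ʳ)
open import Data.List.Relation.Unary.All using ([]; _∷_)
open import Data.List.Relation.Unary.All.Properties using (replicate⁺)
open import Data.List.Relation.Unary.Linked using (Linked; []; [-]; _∷_; tail)
open import Data.Sum using (_⊎_; inj₁; inj₂)
open import Data.Product using (∃; ∃₂; _,_; _×_)
open import Data.Empty using (⊥; ⊥-elim)
open import Data.Unit using (⊤; tt)
open import Function using (_∘_)
open import Relation.Binary.PropositionalEquality
  using (_≡_; refl; sym; trans; cong; cong₂; subst; module ≡-Reasoning)
open import Relation.Nullary using (¬_)

data Suffix : Word → Word → Set where
  here  : ∀ {w} → Suffix w w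
  there : ∀ {s x w} → Suffix s w → Suffix s (x ∷ w)

Suffix-++⁻ : ∀ {x r} xs ys → Suffix (x ∷ r) (xs ++ ys) →
  Suffix (x ∷ r) ys ⊎ ∃ λ t → Suffix (x ∷ t) xs × r ≡ t ++ ys
Suffix-++⁻ []       ys suf       = inj₁ suf
Suffix-++⁻ (x ∷ xs) ys here      = inj₂ (xs , here , refl)
Suffix-++⁻ (x ∷ xs) ys (there suf) with Suffix-++⁻ xs ys suf
... | inj₁ suf′             = inj₁ suf′
... | inj₂ (t , sufₜ , eq) = inj₂ (t , there sufₜ , eq)

drop-Suffix : ∀ i w → Suffix (drop i w) w
drop-Suffix zero    w       = here
drop-Suffix (suc i) []      = here
drop-Suffix (suc i) (x ∷ w) = there (drop-Suffix i w)

S-Suffix-at-end : ∀ {xs t} → NoS xs → Suffix (S ∷ t) (xs ++ S ∷ []) → t ≡ []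
S-Suffix-at-end []        here        = refl
S-Suffix-at-end []        (there ())
S-Suffix-at-end (x≢S ∷ _) here        = ⊥-elim (x≢S refl)
S-Suffix-at-end (_ ∷ noS) (there suf) = S-Suffix-at-end noS suf

S-free-prefix-unique : ∀ {z z′ y y′} → NoS z → NoS z′ →
  z ++ S ∷ y ≡ z′ ++ S ∷ y′ → z ≡ z′
S-free-prefix-unique []        []         _  = refl
S-free-prefix-unique []        (x≢S ∷ _)  refl = ⊥-elim (x≢S refl)
S-free-prefix-unique (x≢S ∷ _) []         refl = ⊥-elim (x≢S refl)
S-free-prefix-unique (_ ∷ noS) (_ ∷ noS′) eq with refl , eq′ ← ∷-injective eq =
  cong (_ ∷_) (S-free-prefix-unique noS noS′ eq′)

S-free-∌S : ∀ {w z y} → NoS w → ¬ z ++ S ∷ y ≡ w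
S-free-∌S {z = []}    (S≢S ∷ _) refl = S≢S refl
S-free-∌S {z = _ ∷ _} (_ ∷ noS) refl = S-free-∌S noS refl

nth-++ˡ : ∀ w t {j} → j < length w → nth (w ++ t) j ≡ nth w j
nth-++ˡ (x ∷ w) t {zero}  _         = refl
nth-++ˡ (x ∷ w) t {suc j} (s≤s j<) = nth-++ˡ w t j<

drop-applyUpTo : ∀ (f : ℕ → Letter) i n w → i + n ≤ length w →
  (∀ k → k < n → f k ≡ nth w (i + k)) → drop i w ≡ applyUpTo f n ++ drop (i + n) w
drop-applyUpTo f zero    zero    w       _        _     = refl
drop-applyUpTo f zero    (suc n) (x ∷ w) (s≤s le) agree =
  cong₂ _∷_ (sym (agree 0 (s≤s z≤n)))
            (drop-applyUpTo (f ∘ suc) zero n w le (λ k k<n → agree (suc k) (s≤s k<n)))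
drop-applyUpTo f (suc i) n       (x ∷ w) (s≤s le) agree = drop-applyUpTo f i n w le agree

CanPrecede : Letter → Letter → Set
CanPrecede _ L = ⊤
CanPrecede S S = ⊥
CanPrecede _ S = ⊤
CanPrecede S M = ⊤
CanPrecede _ M = ⊥

lastφ : Letter → Letter
lastφ S = M
lastφ _ = S

Gap : ℕ → Word → Set
Gap p z = z ≡ replicate p L ⊎ z ≡ M ∷ replicate p L ⊎ z ≡ M ∷ replicate (p ∸ 1) L

module _ (q : ℕ) where

  private
    p : ℕ
    p = suc (suc q)

  block-linked : ∀ k {rest} → Linked CanPrecede (S ∷ rest) →
    Linked CanPrecede (L ∷ (replicate k L ++ S ∷ []) ++ rest)
  block-linked zero    linked = tt ∷ linked
  block-linked (suc k) linked = tt ∷ block-linked k linked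

  lastφ-linked : ∀ {a w} → Linked CanPrecede (a ∷ w) → Linked CanPrecede (lastφ a ∷ φ* p w)
  lastφ-linked {w = []}    [-]        = [-]
  lastφ-linked {w = L ∷ w} (_ ∷ rest) = tt ∷ block-linked (suc q) (lastφ-linked rest)
  lastφ-linked {w = M ∷ w} (_ ∷ rest) = tt ∷ block-linked q (lastφ-linked rest)
  lastφ-linked {L} {S ∷ w} (_ ∷ rest) = tt ∷ lastφ-linked rest
  lastφ-linked {M} {S ∷ w} (_ ∷ rest) = tt ∷ lastφ-linked rest
  lastφ-linked {S} {S ∷ w} (() ∷ _)

  φ*-linked : ∀ {w} → Linked CanPrecede w → Linked CanPrecede (φ* p w)
  φ*-linked {[]}    []     = []
  φ*-linked {L ∷ _} linked = block-linked (suc q) (lastφ-linked linked)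
  φ*-linked {M ∷ _} linked = block-linked q (lastφ-linked linked)
  φ*-linked {S ∷ _} linked = lastφ-linked linked

  iter-linked : ∀ n → Linked CanPrecede (iter p n)
  iter-linked zero    = [-]
  iter-linked (suc n) = φ*-linked (iter-linked n)

  -- z ++ S ∷ y is what follows the S closing the block of a ∈ {L, M}.
  gap-after-block : ∀ a {v z y} → ¬ a ≡ S → Linked CanPrecede (a ∷ v) → NoS z →
    z ++ S ∷ y ≡ φ* p v → Gap p z
  gap-after-block a {L ∷ v} _ _ noS eq =
    inj₁ (S-free-prefix-unique noS (replicate⁺ p λ ()) (trans eq (++-assoc (replicate p L) _ _)))
  gap-after-block L {M ∷ v} _   (() ∷ _) _ _
  gap-after-block M {M ∷ v} _   (() ∷ _) _ _
  gap-after-block S {M ∷ v} a≢S _        _ _ = ⊥-elim (a≢S refl)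
  gap-after-block a {[]}     _ _ _ eq = ⊥-elim (S-free-∌S [] eq)
  gap-after-block a {S ∷ []} _ _ _ eq = ⊥-elim (S-free-∌S ((λ ()) ∷ []) eq)
  gap-after-block a {S ∷ S ∷ v} _ (_ ∷ () ∷ _) _ _
  gap-after-block a {S ∷ L ∷ v} _ _ noS eq =
    inj₂ (inj₁ (S-free-prefix-unique noS ((λ ()) ∷ replicate⁺ p λ ())
      (trans eq (cong (M ∷_) (++-assoc (replicate p L) _ _)))))
  gap-after-block a {S ∷ M ∷ v} _ _ noS eq =
    inj₂ (inj₂ (S-free-prefix-unique noS ((λ ()) ∷ replicate⁺ (suc q) λ ())
      (trans eq (cong (M ∷_) (++-assoc (replicate (suc q) L) _ _)))))

  gap-in-image : ∀ {v z y} → Linked CanPrecede v → NoS z →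
    Suffix (S ∷ z ++ S ∷ y) (φ* p v) → Gap p z
  gap-in-image {[]} _ _ ()
  gap-in-image {a ∷ v} linked noS suf with Suffix-++⁻ (φ p a) (φ* p v) suf
  ... | inj₁ suf′ = gap-in-image (tail linked) noS suf′
  gap-in-image {L ∷ v} linked noS suf | inj₂ (t , sufₜ , eq)
    with refl ← S-Suffix-at-end (replicate⁺ p λ ()) sufₜ = gap-after-block L (λ ()) linked noS eq
  gap-in-image {M ∷ v} linked noS suf | inj₂ (t , sufₜ , eq)
    with refl ← S-Suffix-at-end (replicate⁺ (suc q) λ ()) sufₜ = gap-after-block M (λ ()) linked noS eq
  gap-in-image {S ∷ v} linked noS suf | inj₂ (t , there () , eq)

  iter-head : ∀ n → ∃ λ w → iter p n ≡ L ∷ w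
  iter-head zero = [] , refl
  iter-head (suc n) with w , eq ← iter-head n = _ , cong (φ* p) eq

  length-φ* : ∀ w → length w ≤ length (φ* p w)
  length-φ* []      = z≤n
  length-φ* (L ∷ w) = s≤s (≤-trans (length-φ* w) (length-++-≤ʳ (φ* p w) {replicate (suc q) L ++ S ∷ []}))
  length-φ* (M ∷ w) = s≤s (≤-trans (length-φ* w) (length-++-≤ʳ (φ* p w) {replicate q L ++ S ∷ []}))
  length-φ* (S ∷ w) = s≤s (length-φ* w)

  length-iter-< : ∀ n → length (iter p n) < length (iter p (suc n))
  length-iter-< n with w , eq ← iter-head n rewrite eq =
    s≤s (s≤s (≤-trans (length-φ* w) (length-++-≤ʳ (φ* p w) {replicate q L ++ S ∷ []})))

  length-iter : ∀ n → n < length (iter p n)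
  length-iter zero    = s≤s z≤n
  length-iter (suc n) = ≤-trans (s≤s (length-iter n)) (length-iter-< n)

  iter-prefix-suc : ∀ n → ∃ λ t → iter p (suc n) ≡ iter p n ++ t
  iter-prefix-suc zero = _ , refl
  iter-prefix-suc (suc n) with t , eq ← iter-prefix-suc n =
    φ* p t , trans (cong (φ* p) eq) (concatMap-++ (φ p) (iter p n) t)

  iter-prefix : ∀ {m n} → m ≤′ n → ∃ λ t → iter p n ≡ iter p m ++ t
  iter-prefix ≤′-refl = [] , sym (++-identityʳ _)
  iter-prefix (≤′-step {n} m≤n) with t , eq ← iter-prefix m≤n | t′ , eq′ ← iter-prefix-suc n =
    t ++ t′ , trans eq′ (trans (cong (_++ t′) eq) (++-assoc _ t t′))

  u-nth-iter : ∀ {j n} → j < n → u p j ≡ nth (iter p n) j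
  u-nth-iter {j} j<n with t , eq ← iter-prefix (≤⇒≤′ j<n) =
    sym (trans (cong (λ w → nth w j) eq)
               (nth-++ˡ (iter p (suc j)) t (≤-trans (n≤1+n (suc j)) (length-iter (suc j)))))

  factor-suffix : ∀ {w} → Factor p w → ∃₂ λ n rest → Suffix (w ++ rest) (iter p (suc n))
  factor-suffix {w} (i , window≡w) = N , drop N W , subst (λ s → Suffix s W) occurrence (drop-Suffix i W)
    where
      N = i + length w
      W = iter p (suc N)
      agree : ∀ k → k < length w → u p (i + k) ≡ nth W (i + k)
      agree k k<n = u-nth-iter (m<n⇒m<1+n (+-monoʳ-< i k<n))
      open ≡-Reasoning
      occurrence : drop i W ≡ w ++ drop N W
      occurrence = begin
        drop i W
          ≡⟨ drop-applyUpTo _ i (length w) W (≤-trans (n≤1+n N) (<⇒≤ (length-iter (suc N)))) agree ⟩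
        applyUpTo (λ k → u p (i + k)) (length w) ++ drop N W
          ≡⟨ cong (_++ drop N W) (trans (sym (map-upTo _ (length w))) window≡w) ⟩
        w ++ drop N W ∎

mainTheorem8 : (p : ℕ) → 1 < p → (z′ : Word) → NoS z′
    → Factor p (S ∷ z′ ++ S ∷ [])
    → z′ ≡ replicate p L ⊎ z′ ≡ M ∷ replicate p L ⊎ z′ ≡ M ∷ replicate (p ∸ 1) L
mainTheorem8 (suc (suc q)) (s≤s (s≤s _)) z′ noS factor with n , rest , suf ← factor-suffix q factor =
  gap-in-image q (iter-linked q n) noS
    (subst (λ s → Suffix s (iter (suc (suc q)) (suc n))) (cong (S ∷_) (++-assoc z′ (S ∷ []) rest)) suf)
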